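{- Consider the BML dynamics with $m$ cars on $\mathbb{Z}_N\times\mathbb{Z}_N$, and for each time $t\ge 0$ let $S_t=\{Y^1_t,\dots,Y^m_t\}\subseteq\mathbb{Z}_N$ be the set of time-corrected diagonal values of the cars. Suppose that at some time $t$ there is a maximal empty arc $\{y,y+1,\dots,y+l\}$ of $\mathbb{Z}_N\setminus S_t$ with $l\ge 1$ (i.e. containing at least two points). Then at time $t+1$ the point $y-1$ still lies in $S_{t+1}$, and none of the points $y,y+1,\dots,y+l-1$ lies in $S_{t+1}$.
   Context: Write $\mathbb{Z}_N=\mathbb{Z}/N\mathbb{Z}$ and consider the torus $\mathbb{Z}_N\times\mathbb{Z}_N$; the first coordinate points vertically ("up" means increasing the first coordinate) and the second horizontally ("right" means increasing the second coordinate). A configuration consists of $m<N^2$ cars at distinct sites, each coloured red or blue. Each time step consists of two sub-steps. First all blue cars try to move simultaneously one step right: a blue car at $(i,j)$ fails to move if and only if for some $k\ge 0$ the sites $(i,j+1),\dots,(i,j+k)$ hold blue cars and $(i,j+k+1)$ holds a red car; all other blue cars move one step right. Then, in the resulting configuration, all red cars try to move simultaneously one step up: a red car at $(i,j)$ fails to move if and only if for some $k\ge0$ the sites $(i+1,j),\dots,(i+k,j)$ hold red cars and $(i+k+1,j)$ holds a blue car; all other red cars move one step up. Let $X^i_t$ be the position of car $i$ at time $t$, and define $\phi_t:\mathbb{Z}_N^2\to\mathbb{Z}_N$ by $\phi_t(a,b)=a+b-t \bmod N$ and $Y^i_t=\phi_t(X^i_t)$. A maximal empty arc at time $t$ is a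 set $\{y,y+1,\dots,y+l\}\subseteq\mathbb{Z}_N\setminus S_t$ of consecutive points (mod $N$) such that $y-1\in S_t$ and $y+l+1\in S_t$; the sets $\mathbb{Z}_N\setminus S_t$ is partitioned into such arcs whenever $S_t\neq\emptyset$. -}

module Defs where

open import Data.Nat using (ℕ; zero; suc; _+_; _*_; _∸_; _≤_; _<_; NonZero)
open import Data.Nat.DivMod using (_mod_)
open import Data.Fin using (Fin; toℕ)
open import Data.Product using (_×_; _,_; ∃; ∃-syntax; Σ)
open import Relation.Binary.PropositionalEquality using (_≡_)
open import Relation.Nullary using (¬_)
open import Function.Definitions using (Injective)

data Colour : Set where
  red blue : Colour

module BML (N : ℕ) .{{_ : NonZero N}} where

  -- ℤ_N is represented by Fin N; a site (i , j): i = vertical, j = horizontal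
  ZN : Set
  ZN = Fin N

  Site : Set
  Site = ZN × ZN

  _⊕_ : ZN → ℕ → ZN
  a ⊕ k = (toℕ a + k) mod N

  -- a ⊖ k = a - k mod N  (computed as a + (N-1)k, since -k ≡ (N-1)k mod N)
  _⊖_ : ZN → ℕ → ZN
  a ⊖ k = (toℕ a + (N ∸ 1) * k) mod N

  right : Site → Site
  right (i , j) = (i , j ⊕ 1)

  up : Site → Site
  up (i , j) = (i ⊕ 1 , j)

  module _ {m : ℕ} (col : Fin m → Colour) where

    Holds : (Fin m → Site) → Site → Colour → Set
    Holds X s c = ∃[ c' ] (X c' ≡ s × col c' ≡ c)

    BlueBlocked : (Fin m → Site) → Site → Set
    BlueBlocked X (i , j) =
      ∃[ k ] ((∀ r → 1 ≤ r → r ≤ k → Holds X (i , j ⊕ r) blue)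
             × Holds X (i , j ⊕ suc k) red)

    RedBlocked : (Fin m → Site) → Site → Set
    RedBlocked X (i , j) =
      ∃[ k ] ((∀ r → 1 ≤ r → r ≤ k → Holds X (i ⊕ r , j) red)
             × Holds X (i ⊕ suc k , j) blue)

    BlueStep : (Fin m → Site) → (Fin m → Site) → Set
    BlueStep X X' = ∀ c →
      (col c ≡ red → X' c ≡ X c) ×
      (col c ≡ blue → BlueBlocked X (X c) → X' c ≡ X c) ×
      (col c ≡ blue → ¬ BlueBlocked X (X c) → X' c ≡ right (X c))

    RedStep : (Fin m → Site) → (Fin m → Site) → Set
    RedStep X X' = ∀ c →
      (col c ≡ blue → X' c ≡ X c) ×
      (col c ≡ red → RedBlocked X (X c) → X' c ≡ X c) ×
      (col c ≡ red → ¬ RedBlocked X (X c) → X' c ≡ up (X c))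

    Step : (Fin m → Site) → (Fin m → Site) → Set
    Step X X' = Σ (Fin m → Site) λ Z → BlueStep X Z × RedStep Z X'

    IsBMLTrajectory : (ℕ → Fin m → Site) → Set
    IsBMLTrajectory X = (m < N * N) × Injective _≡_ _≡_ (X 0)
                        × (∀ t → Step (X t) (X (suc t)))

  φ : ℕ → Site → ZN
  φ t (a , b) = (a ⊕ toℕ b) ⊖ t

  -- membership in S_t = { Y^i_t } = { φ_t (X^i_t) }
  module _ {m : ℕ} where
    InS : (ℕ → Fin m → Site) → ℕ → ZN → Set
    InS X t z = ∃[ c ] (φ t (X t c) ≡ z)

    MaximalEmptyArc : (ℕ → Fin m → Site) → ℕ → ZN → ℕ → Set
    MaximalEmptyArc X t y l =
      (∀ i → i ≤ l → ¬ InS X t (y ⊕ i)) × InS X t (y ⊖ 1) × InS X t (y ⊕ suc l)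

{-# OPTIONS --safe #-}
module Submission where

-- A car either stays, which lowers its time-corrected diagonal φ by one, or advances to its
-- front site (right if blue, up if red), which keeps φ.  Hence every point of S_{t+1} is z with
-- z or z + 1 in S_t, so y, …, y + l - 1 are no longer occupied.  A car on y - 1 has its front
-- site on diagonal y, hence free; a blue car then moves, and a red car is either unblocked or
-- blocked by a blue car that has just moved in front of it and stays there.  Either way the
-- front site is occupied at time t + 1, and it lies on diagonal y - 1 at that time.

open import Defs
open import Data.Nat using (ℕ; suc; _+_; _*_; _∸_; _%_; _≤_; _<_; NonZero; >-nonZero⁻¹; s≤s; z≤n)
open import Data.Nat.Properties using (+-assoc; +-comm; +-identityʳ; *-distribˡ-+; m∸n+n≡m; <⇒≤)
open import Data.Nat.DivMod using (_mod_; %-distribˡ-+; m%n%n≡m%n; [m+kn]%n≡m%n; m<n⇒m%n≡m)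
open import Data.Nat.Tactic.RingSolver using (solve-∀)
open import Data.Fin using (Fin; toℕ; _≟_)
open import Data.Fin.Properties using (toℕ<n; toℕ-fromℕ<; fromℕ<-toℕ; fromℕ<-cong; any?)
open import Data.Product using (_×_; _,_; proj₁; proj₂; ∃-syntax)
open import Data.Sum using (_⊎_; inj₁; inj₂)
open import Relation.Nullary using (¬_; Dec; yes; no; contradiction)
open import Relation.Nullary.Decidable using (decidable-stable; ¬¬-excluded-middle)
open import Relation.Nullary.Negation using (¬¬-map)
open import Relation.Binary.PropositionalEquality using (_≡_; sym; trans; cong; subst; module ≡-Reasoning)

module Motion (N : ℕ) .{{_ : NonZero N}} where
  open BML N

  front : Colour → Site → Site
  front red  = up
  front blue = right

  Occupied : ∀ {m} → (Fin m → Site) → Site → Set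
  Occupied X s = ∃[ d ] X d ≡ s

  module _ {m : ℕ} (col : Fin m → Colour) where

    BlueBlocked⇒right-occupied : ∀ {X} s → BlueBlocked col X s → Occupied X (right s)
    BlueBlocked⇒right-occupied _ (0 , _ , d , Xd≡ , _) = d , Xd≡
    BlueBlocked⇒right-occupied _ (suc _ , blues , _) with blues 1 (s≤s z≤n) (s≤s z≤n)
    ... | d , Xd≡ , _ = d , Xd≡

    RedBlocked⇒up-occupied : ∀ {X} s → RedBlocked col X s → Occupied X (up s)
    RedBlocked⇒up-occupied _ (0 , _ , d , Xd≡ , _) = d , Xd≡
    RedBlocked⇒up-occupied _ (suc _ , reds , _) with reds 1 (s≤s z≤n) (s≤s z≤n)
    ... | d , Xd≡ , _ = d , Xd≡

    module _ {X Z X' : Fin m → Site} (blue-step : BlueStep col X Z) (red-step : RedStep col Z X') where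

      -- Blocking is not decidable here, so case splits on it are made under a double negation.
      stays-or-advances : ∀ c → ¬ ¬ (X' c ≡ X c ⊎ X' c ≡ front (col c) (X c))
      stays-or-advances c with col c in colour
      ... | blue = ¬¬-map outcome ¬¬-excluded-middle
        where
        outcome : Dec (BlueBlocked col X (X c)) → X' c ≡ X c ⊎ X' c ≡ right (X c)
        outcome (yes blocked) = inj₁ (trans (proj₁ (red-step c) colour) (proj₁ (proj₂ (blue-step c)) colour blocked))
        outcome (no free)     = inj₂ (trans (proj₁ (red-step c) colour) (proj₂ (proj₂ (blue-step c)) colour free))
      ... | red = ¬¬-map outcome ¬¬-excluded-middle
        where
        Zc≡Xc : Z c ≡ X c
        Zc≡Xc = proj₁ (blue-step c) colour

        outcome : Dec (RedBlocked col Z (Z c)) → X' c ≡ X c ⊎ X' c ≡ up (X c)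
        outcome (yes blocked) = inj₁ (trans (proj₁ (proj₂ (red-step c)) colour blocked) Zc≡Xc)
        outcome (no free)     = inj₂ (trans (proj₂ (proj₂ (red-step c)) colour free) (cong up Zc≡Xc))

      free-front-filled : ∀ c → ¬ Occupied X (front (col c) (X c)) → ¬ ¬ Occupied X' (front (col c) (X c))
      free-front-filled c with col c in colour
      ... | blue = λ free → contradiction (c , moves free)
        where
        moves : ¬ Occupied X (right (X c)) → X' c ≡ right (X c)
        moves free = trans (proj₁ (red-step c) colour)
          (proj₂ (proj₂ (blue-step c)) colour (λ blocked → free (BlueBlocked⇒right-occupied (X c) blocked)))
      ... | red = λ free → ¬¬-map (outcome free) ¬¬-excluded-middle
        where
        Zc≡Xc : Z c ≡ X c
        Zc≡Xc = proj₁ (blue-step c) colour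

        blocker : ¬ Occupied X (up (X c)) → ∀ d → Z d ≡ up (X c) → Occupied X' (up (X c))
        blocker free d Zd≡ with col d in colour′
        ... | blue = d , trans (proj₁ (red-step d) colour′) Zd≡
        ... | red  = contradiction (d , trans (sym (proj₁ (blue-step d) colour′)) Zd≡) free

        outcome : ¬ Occupied X (up (X c)) → Dec (RedBlocked col Z (Z c)) → Occupied X' (up (X c))
        outcome free (no unblocked) = c , trans (proj₂ (proj₂ (red-step c)) colour unblocked) (cong up Zc≡Xc)
        outcome free (yes blocked) with RedBlocked⇒up-occupied (Z c) blocked
        ... | d , Zd≡ = blocker free d (trans Zd≡ (cong up Zc≡Xc))

module Diagonal (N : ℕ) .{{_ : NonZero N}} where
  open BML N
  open Motion N using (front)
  open ≡-Reasoning

  mod-cong : ∀ {a b} → a % N ≡ b % N → a mod N ≡ b mod N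
  mod-cong {a} {b} a≡b = fromℕ<-cong (a % N) (b % N) a≡b _ _

  toℕ-mod : (a : ZN) → toℕ a mod N ≡ a
  toℕ-mod a = trans (fromℕ<-cong _ _ (m<n⇒m%n≡m (toℕ<n a)) _ (toℕ<n a)) (fromℕ<-toℕ a _)

  mod-absorbˡ : ∀ a b → (toℕ (a mod N) + b) mod N ≡ (a + b) mod N
  mod-absorbˡ a b = mod-cong (begin
    (toℕ (a mod N) + b) % N  ≡⟨ cong (λ x → (x + b) % N) (toℕ-fromℕ< _) ⟩
    (a % N + b) % N          ≡⟨ %-distribˡ-+ (a % N) b N ⟩
    (a % N % N + b % N) % N  ≡⟨ cong (λ x → (x + b % N) % N) (m%n%n≡m%n a N) ⟩
    (a % N + b % N) % N      ≡⟨ %-distribˡ-+ a b N ⟨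
    (a + b) % N              ∎)

  mod-absorbʳ : ∀ a b → (a + toℕ (b mod N)) mod N ≡ (a + b) mod N
  mod-absorbʳ a b = begin
    (a + toℕ (b mod N)) mod N  ≡⟨ cong (_mod N) (+-comm a _) ⟩
    (toℕ (b mod N) + a) mod N  ≡⟨ mod-absorbˡ b a ⟩
    (b + a) mod N              ≡⟨ cong (_mod N) (+-comm b a) ⟩
    (a + b) mod N              ∎

  ⊕-identityʳ : (a : ZN) → a ⊕ 0 ≡ a
  ⊕-identityʳ a = trans (cong (_mod N) (+-identityʳ (toℕ a))) (toℕ-mod a)

  ⊕-assoc : (a : ZN) (k l : ℕ) → (a ⊕ k) ⊕ l ≡ a ⊕ (k + l)
  ⊕-assoc a k l = trans (mod-absorbˡ (toℕ a + k) l) (cong (_mod N) (+-assoc (toℕ a) k l))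

  ⊖-assoc : (a : ZN) (k l : ℕ) → (a ⊖ k) ⊖ l ≡ a ⊖ (k + l)
  ⊖-assoc a k l = begin
    (a ⊖ k) ⊖ l                                     ≡⟨ mod-absorbˡ (toℕ a + (N ∸ 1) * k) ((N ∸ 1) * l) ⟩
    (toℕ a + (N ∸ 1) * k + (N ∸ 1) * l) mod N      ≡⟨ cong (_mod N) (+-assoc (toℕ a) _ _) ⟩
    (toℕ a + ((N ∸ 1) * k + (N ∸ 1) * l)) mod N    ≡⟨ cong (λ x → (toℕ a + x) mod N) (*-distribˡ-+ (N ∸ 1) k l) ⟨
    a ⊖ (k + l)                                     ∎

  ⊕-⊖-comm : (a : ZN) (k l : ℕ) → (a ⊕ k) ⊖ l ≡ (a ⊖ l) ⊕ k
  ⊕-⊖-comm a k l = begin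
    (a ⊕ k) ⊖ l                            ≡⟨ mod-absorbˡ (toℕ a + k) ((N ∸ 1) * l) ⟩
    (toℕ a + k + (N ∸ 1) * l) mod N       ≡⟨ cong (_mod N) (swap (toℕ a) k ((N ∸ 1) * l)) ⟩
    (toℕ a + (N ∸ 1) * l + k) mod N       ≡⟨ mod-absorbˡ (toℕ a + (N ∸ 1) * l) k ⟨
    (a ⊖ l) ⊕ k                            ∎
    where
    swap : ∀ x y z → x + y + z ≡ x + z + y
    swap = solve-∀

  ⊖-⊕-cancel : (a : ZN) (k : ℕ) → (a ⊖ k) ⊕ k ≡ a
  ⊖-⊕-cancel a k = begin
    (a ⊖ k) ⊕ k                             ≡⟨ mod-absorbˡ (toℕ a + (N ∸ 1) * k) k ⟩
    (toℕ a + (N ∸ 1) * k + k) mod N        ≡⟨ cong (_mod N) (collect (toℕ a) (N ∸ 1) k) ⟩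
    (toℕ a + k * (N ∸ 1 + 1)) mod N        ≡⟨ cong (λ n → (toℕ a + k * n) mod N) (m∸n+n≡m (>-nonZero⁻¹ N)) ⟩
    (toℕ a + k * N) mod N                   ≡⟨ mod-cong ([m+kn]%n≡m%n (toℕ a) k N) ⟩
    toℕ a mod N                             ≡⟨ toℕ-mod a ⟩
    a                                       ∎
    where
    collect : ∀ x n k → x + n * k + k ≡ x + k * (n + 1)
    collect = solve-∀

  ⊕-⊖-cancel : (a : ZN) (k : ℕ) → (a ⊕ k) ⊖ k ≡ a
  ⊕-⊖-cancel a k = trans (⊕-⊖-comm a k k) (⊖-⊕-cancel a k)

  ⊕-toℕ-⊕ : (a b : ZN) (k : ℕ) → a ⊕ toℕ (b ⊕ k) ≡ (a ⊕ toℕ b) ⊕ k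
  ⊕-toℕ-⊕ a b k = begin
    a ⊕ toℕ (b ⊕ k)                  ≡⟨ mod-absorbʳ (toℕ a) (toℕ b + k) ⟩
    (toℕ a + (toℕ b + k)) mod N      ≡⟨ cong (_mod N) (+-assoc (toℕ a) (toℕ b) k) ⟨
    (toℕ a + toℕ b + k) mod N        ≡⟨ mod-absorbˡ (toℕ a + toℕ b) k ⟨
    (a ⊕ toℕ b) ⊕ k                  ∎

  diagonal : Site → ZN
  diagonal (i , j) = i ⊕ toℕ j

  diagonal-front : ∀ k s → diagonal (front k s) ≡ diagonal s ⊕ 1
  diagonal-front blue (i , j) = ⊕-toℕ-⊕ i j 1
  diagonal-front red  (i , j) = begin
    (i ⊕ 1) ⊕ toℕ j        ≡⟨ ⊕-assoc i 1 (toℕ j) ⟩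
    i ⊕ (1 + toℕ j)        ≡⟨ cong (i ⊕_) (+-comm 1 (toℕ j)) ⟩
    i ⊕ (toℕ j + 1)        ≡⟨ ⊕-assoc i (toℕ j) 1 ⟨
    (i ⊕ toℕ j) ⊕ 1        ∎

  φ-suc : ∀ t s → φ (suc t) s ≡ φ t s ⊖ 1
  φ-suc t s = begin
    diagonal s ⊖ suc t         ≡⟨ cong (diagonal s ⊖_) (+-comm 1 t) ⟩
    diagonal s ⊖ (t + 1)       ≡⟨ ⊖-assoc (diagonal s) t 1 ⟨
    (diagonal s ⊖ t) ⊖ 1       ∎

  φ-front : ∀ t k s → φ t (front k s) ≡ φ t s ⊕ 1
  φ-front t k s = begin
    diagonal (front k s) ⊖ t   ≡⟨ cong (_⊖ t) (diagonal-front k s) ⟩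
    (diagonal s ⊕ 1) ⊖ t       ≡⟨ ⊕-⊖-comm (diagonal s) 1 t ⟩
    (diagonal s ⊖ t) ⊕ 1       ∎

  φ-suc-front : ∀ t k s → φ (suc t) (front k s) ≡ φ t s
  φ-suc-front t k s = begin
    φ (suc t) (front k s)     ≡⟨ φ-suc t (front k s) ⟩
    φ t (front k s) ⊖ 1       ≡⟨ cong (_⊖ 1) (φ-front t k s) ⟩
    (φ t s ⊕ 1) ⊖ 1           ≡⟨ ⊕-⊖-cancel (φ t s) 1 ⟩
    φ t s                     ∎

module Evolution (N : ℕ) .{{_ : NonZero N}} {m : ℕ} (col : Fin m → Colour)
    (X : ℕ → Fin m → BML.Site N) (t : ℕ) (step : BML.Step N col (X t) (X (suc t))) where
  open BML N
  open Motion N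
  open Diagonal N
  open ≡-Reasoning

  private
    blue-step : BlueStep col (X t) (proj₁ step)
    blue-step = proj₁ (proj₂ step)

    red-step : RedStep col (proj₁ step) (X (suc t))
    red-step = proj₂ (proj₂ step)

  InS? : ∀ u z → Dec (InS X u z)
  InS? u z = any? (λ c → φ u (X u c) ≟ z)

  InS-suc⇒InS⊎InS-⊕1 : ∀ z → InS X (suc t) z → ¬ ¬ (InS X t z ⊎ InS X t (z ⊕ 1))
  InS-suc⇒InS⊎InS-⊕1 z (c , Y′≡z) = ¬¬-map origin (stays-or-advances col blue-step red-step c)
    where
    origin : X (suc t) c ≡ X t c ⊎ X (suc t) c ≡ front (col c) (X t c) → InS X t z ⊎ InS X t (z ⊕ 1)
    origin (inj₁ stays) = inj₂ (c , (begin
      φ t (X t c)                    ≡⟨ ⊖-⊕-cancel (φ t (X t c)) 1 ⟨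
      (φ t (X t c) ⊖ 1) ⊕ 1          ≡⟨ cong (_⊕ 1) (φ-suc t (X t c)) ⟨
      φ (suc t) (X t c) ⊕ 1          ≡⟨ cong (λ s → φ (suc t) s ⊕ 1) stays ⟨
      φ (suc t) (X (suc t) c) ⊕ 1    ≡⟨ cong (_⊕ 1) Y′≡z ⟩
      z ⊕ 1                          ∎))
    origin (inj₂ advances) = inj₁ (c , (begin
      φ t (X t c)                    ≡⟨ φ-suc-front t (col c) (X t c) ⟨
      φ (suc t) (front (col c) (X t c)) ≡⟨ cong (φ (suc t)) advances ⟨
      φ (suc t) (X (suc t) c)        ≡⟨ Y′≡z ⟩
      z                              ∎))

  InS-persists-before-gap : ∀ z → InS X t z → ¬ InS X t (z ⊕ 1) → InS X (suc t) z
  InS-persists-before-gap z (c , Y≡z) gap =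
    decidable-stable (InS? (suc t) z) (¬¬-map filled (free-front-filled col blue-step red-step c free))
    where
    ahead : Site
    ahead = front (col c) (X t c)

    free : ¬ Occupied (X t) ahead
    free (d , Xd≡ahead) = gap (d , (begin
      φ t (X t d)        ≡⟨ cong (φ t) Xd≡ahead ⟩
      φ t ahead          ≡⟨ φ-front t (col c) (X t c) ⟩
      φ t (X t c) ⊕ 1    ≡⟨ cong (_⊕ 1) Y≡z ⟩
      z ⊕ 1              ∎))

    filled : Occupied (X (suc t)) ahead → InS X (suc t) z
    filled (d , X′d≡ahead) = d , (begin
      φ (suc t) (X (suc t) d)   ≡⟨ cong (φ (suc t)) X′d≡ahead ⟩
      φ (suc t) ahead           ≡⟨ φ-suc-front t (col c) (X t c) ⟩
      φ t (X t c)               ≡⟨ Y≡z ⟩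
      z                         ∎)

lemma2 : (N : ℕ) .{{_ : NonZero N}} (m : ℕ) (col : Fin m → Colour)
    (X : ℕ → Fin m → BML.Site N) → BML.IsBMLTrajectory N col X →
    (t : ℕ) (y : BML.ZN N) (l : ℕ) → 1 ≤ l → BML.MaximalEmptyArc N X t y l →
    BML.InS N X (suc t) (BML._⊖_ N y 1)
    × (∀ i → i < l → ¬ BML.InS N X (suc t) (BML._⊕_ N y i))
lemma2 N m col X (_ , _ , steps) t y l _ (empty , before , _) = persists , stays-empty
  where
  open BML N
  open Diagonal N
  open Evolution N col X t (steps t)

  persists : InS X (suc t) (y ⊖ 1)
  persists = InS-persists-before-gap (y ⊖ 1) before
    (subst (λ z → ¬ InS X t z) (trans (⊕-identityʳ y) (sym (⊖-⊕-cancel y 1))) (empty 0 z≤n))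

  stays-empty : ∀ i → i < l → ¬ InS X (suc t) (y ⊕ i)
  stays-empty i i<l inS = InS-suc⇒InS⊎InS-⊕1 (y ⊕ i) inS λ
    { (inj₁ inS-i)   → empty i (<⇒≤ i<l) inS-i
    ; (inj₂ inS-i+1) → empty (suc i) i<l (subst (InS X t) (trans (⊕-assoc y i 1) (cong (y ⊕_) (+-comm i 1))) inS-i+1) }
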